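{- Let $G$ be a finite simple graph that is $\alpha_1^{+}$-stable, let $v$ be the vertex with $\{v\}=\bigcap\{S:S\in\Omega(G)\}$, and let $G_0=G-N[v]$ be the subgraph induced by the vertices not in the closed neighbourhood $N[v]=N(v)\cup\{v\}$. Then $G$ is $\alpha_{P_3}^{+}$-stable if and only if for every pair of vertices $x,y\in V(G_0)$ there exists $S_0\in\Omega(G_0)$ with $x,y\in V(G_0)-S_0$.
   Context: $\alpha(G)$ is the maximum size of a stable set; $\Omega(G)$ is the set of maximum stable sets; $\xi(G)=|\bigcap\{S:S\in\Omega(G)\}|$. $G$ is $\alpha_1^{+}$-stable if $\xi(G)=1$. For $e\in E(\overline{G})$ (a pair of distinct non-adjacent vertices), $G+e$ denotes $G$ with $e$ added. $G$ is $\alpha_{P_3}^{+}$-stable if $\alpha(G+e_1+e_2)=\alpha(G)$ for any $e_1,e_2\in E(\overline{G})$ (not necessarily distinct) having a common endpoint. -}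

module Defs where

open import Data.Nat using (ℕ; _≤_)
open import Data.Bool using (Bool; true; false; _∨_; _∧_; not)
open import Data.Vec using (tabulate)
open import Data.Fin using (Fin; _≟_)
open import Data.Fin.Subset using (Subset; _∈_; _∉_; _⊆_; ∣_∣; ⊤)
open import Data.Product using (Σ; _×_; _,_)
open import Relation.Binary.PropositionalEquality using (_≡_; _≢_)
open import Relation.Nullary using (does)

Adj : ℕ → Set
Adj n = Fin n → Fin n → Bool

record Graph (n : ℕ) : Set where
  field
    adj    : Adj n
    sym    : ∀ x y → adj x y ≡ adj y x
    irrefl : ∀ x → adj x x ≡ false
open Graph public

Stable : ∀ {n} → Adj n → Subset n → Set
Stable E S = ∀ x y → x ∈ S → y ∈ S → E x y ≡ false

-- Stable sets of the subgraph induced by the vertex set U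
-- (a stable set of G[U] is exactly a stable set of G contained in U).
StableIn : ∀ {n} → Adj n → Subset n → Subset n → Set
StableIn E U S = S ⊆ U × Stable E S

HasAlphaIn : ∀ {n} → Adj n → Subset n → ℕ → Set
HasAlphaIn E U k =
  (Σ (Subset _) λ S → StableIn E U S × ∣ S ∣ ≡ k)
  × (∀ T → StableIn E U T → ∣ T ∣ ≤ k)

InOmegaIn : ∀ {n} → Adj n → Subset n → Subset n → Set
InOmegaIn E U S = StableIn E U S × (∀ T → StableIn E U T → ∣ T ∣ ≤ ∣ S ∣)

HasAlpha : ∀ {n} → Adj n → ℕ → Set
HasAlpha E = HasAlphaIn E ⊤

InOmega : ∀ {n} → Adj n → Subset n → Set
InOmega E = InOmegaIn E ⊤

InCore : ∀ {n} → Adj n → Fin n → Set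
InCore E x = ∀ S → InOmega E S → x ∈ S

-- G is α₁⁺-stable with ⋂ Ω(G) = {v}  (i.e. ξ(G) = 1, the unique vertex being v)
CoreIsSingleton : ∀ {n} → Graph n → Fin n → Set
CoreIsSingleton G v = InCore (adj G) v × (∀ x → InCore (adj G) x → x ≡ v)

_==_ : ∀ {n} → Fin n → Fin n → Bool
x == y = does (x ≟ y)

addEdge : ∀ {n} → Adj n → Fin n → Fin n → Adj n
addEdge E a b x y = E x y ∨ (((x == a) ∧ (y == b)) ∨ ((x == b) ∧ (y == a)))

NonEdge : ∀ {n} → Graph n → Fin n → Fin n → Set
NonEdge G a b = a ≢ b × adj G a b ≡ false

-- G is α_{P₃}⁺-stable: for all e₁ = ab, e₂ = ac in E(Ḡ) (common endpoint a,
-- possibly b = c, i.e. e₁ = e₂), α(G + e₁ + e₂) = α(G).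
P3Stable : ∀ {n} → Graph n → Set
P3Stable G = ∀ a b c → NonEdge G a b → NonEdge G a c →
  ∀ k → HasAlpha (adj G) k → HasAlpha (addEdge (addEdge (adj G) a b) a c) k

-- V(G₀) = V(G) − N[v], where N[v] = {v} ∪ {x : x adjacent to v};
-- G₀ = G − N[v] is the subgraph of G induced by this vertex set.
V₀ : ∀ {n} → Graph n → Fin n → Subset n
V₀ G v = tabulate (λ x → not ((x == v) ∨ adj G v x))

{-# OPTIONS --safe #-}

-- Since v lies in every maximum stable set of G, S ↦ S − v maps Ω(G) into
-- Ω(G₀) and S₀ ↦ S₀ ∪ {v} maps Ω(G₀) into Ω(G); so α(G) = α(G₀) + 1.
-- Adding the path b – a – c keeps α iff some S ∈ Ω(G) avoids a or avoids both
-- b and c. For a = v this asks for some S₀ ∈ Ω(G₀) missing b and c. For a ≠ v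
-- a maximum stable set avoiding a always exists: either a given one misses a,
-- or it contains a together with v, so a ∈ V(G₀) and the lift of some
-- S₀ ∈ Ω(G₀) missing a works. Only v ∈ ⋂ Ω(G) is used, not its uniqueness.

module Submission where

open import Defs hiding (sym)
open import Data.Nat using (ℕ; zero; suc; _≤_; s≤s; z≤n; _≟_)
open import Data.Nat.Properties
  using (module ≤-Reasoning; ≤-trans; ≤-antisym; ≤-pred; ≤∧≢⇒<; m<1+n⇒m≤n)
open import Data.Bool using (true; false; not; _∨_)
import Data.Bool as Bool
open import Data.Bool.Properties using (∧-zeroʳ; ∨-zeroʳ)
open import Data.Vec using (_∷_; lookup)
open import Data.Vec.Properties using ([]=⇒lookup; lookup⇒[]=; lookup∘tabulate)
open import Data.Fin using (Fin; zero; suc) renaming (_≟_ to _≟ᶠ_)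
open import Data.Fin.Properties using (all?)
open import Data.Fin.Subset
  using (Subset; _∈_; _∉_; _⊆_; ∣_∣; ⊤; ⊥; ⁅_⁆; _∪_; _-_)
open import Data.Fin.Subset.Properties
  using (_∈?_; _⊆?_; ⊆⊤; ∉⊥; ∣p∣≤n; anySubset?; ∪-identityˡ; p─⊥≡p; p─q⊆p;
         x∈p∪q⁻; x∈⁅y⁆⇒x≡y)
open import Data.Vec.Base using (here; there)
open import Data.Product using (Σ; ∃; _×_; _,_; proj₁; proj₂)
open import Data.Sum using (_⊎_; inj₁; inj₂)
open import Data.Empty using (⊥-elim)
open import Function using (_∘_)
open import Function.Bundles using (_⇔_; mk⇔; Equivalence)
open import Function.Construct.Composition using (_⇔-∘_)
open import Level using (0ℓ)
open import Relation.Nullary using (yes; no)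
open import Relation.Nullary.Decidable using (_×-dec_; _→-dec_; dec-true; dec-false)
open import Relation.Unary using (Pred; Decidable)
open import Relation.Binary.PropositionalEquality
  using (_≡_; _≢_; refl; sym; trans; cong; cong₂; subst; module ≡-Reasoning)

private
  variable
    n k : ℕ
    x y v a b c : Fin n
    p S T S₀ : Subset n
    E E′ : Adj n

∣⁅x⁆∪p∣≡1+∣p∣ : ∀ p → x ∉ p → ∣ ⁅ x ⁆ ∪ p ∣ ≡ suc ∣ p ∣
∣⁅x⁆∪p∣≡1+∣p∣ {x = zero}  (true  ∷ p) x∉p = ⊥-elim (x∉p here)
∣⁅x⁆∪p∣≡1+∣p∣ {x = zero}  (false ∷ p) x∉p = cong suc (cong ∣_∣ (∪-identityˡ p))
∣⁅x⁆∪p∣≡1+∣p∣ {x = suc x} (true  ∷ p) x∉p = cong suc (∣⁅x⁆∪p∣≡1+∣p∣ p (x∉p ∘ there))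
∣⁅x⁆∪p∣≡1+∣p∣ {x = suc x} (false ∷ p) x∉p = ∣⁅x⁆∪p∣≡1+∣p∣ p (x∉p ∘ there)

∣p∣≡1+∣p-x∣ : ∀ p → x ∈ p → ∣ p ∣ ≡ suc ∣ p - x ∣
∣p∣≡1+∣p-x∣ {x = zero}  (true  ∷ p) here       = cong suc (cong ∣_∣ (sym (p─⊥≡p p)))
∣p∣≡1+∣p-x∣ {x = suc x} (true  ∷ p) (there x∈p) = cong suc (∣p∣≡1+∣p-x∣ p x∈p)
∣p∣≡1+∣p-x∣ {x = suc x} (false ∷ p) (there x∈p) = ∣p∣≡1+∣p-x∣ p x∈p

x∉p-x : ∀ p → x ∉ p - x
x∉p-x {x = suc x} (_ ∷ p) (there x∈p-x) = x∉p-x p x∈p-x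

x∈p-y⇒x≢y : x ∈ p - y → x ≢ y
x∈p-y⇒x≢y {p = p} x∈p-x refl = x∉p-x p x∈p-x

x≢y∧x∉p⇒x∉⁅y⁆∪p : x ≢ y → x ∉ p → x ∉ ⁅ y ⁆ ∪ p
x≢y∧x∉p⇒x∉⁅y⁆∪p {y = y} {p = p} x≢y x∉p x∈⁅y⁆∪p with x∈p∪q⁻ ⁅ y ⁆ p x∈⁅y⁆∪p
... | inj₁ x∈⁅y⁆ = x≢y (x∈⁅y⁆⇒x≡y y x∈⁅y⁆)
... | inj₂ x∈p   = x∉p x∈p

module _ {P : Pred (Subset n) 0ℓ} (P? : Decidable P) where

  private
    largest-below : ∀ k → (∀ T → P T → ∣ T ∣ ≤ k) → ∃ P →
      ∃ λ S → P S × (∀ T → P T → ∣ T ∣ ≤ ∣ S ∣)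
    largest-below zero    bound (S , PS) = S , PS , λ T PT → ≤-trans (bound T PT) z≤n
    largest-below (suc k) bound ∃P with anySubset? (λ T → P? T ×-dec (∣ T ∣ ≟ suc k))
    ... | yes (S , PS , ∣S∣≡1+k) =
      S , PS , λ T PT → subst (∣ T ∣ ≤_) (sym ∣S∣≡1+k) (bound T PT)
    ... | no ∄ = largest-below k
      (λ T PT → m<1+n⇒m≤n (≤∧≢⇒< (bound T PT) (λ ∣T∣≡1+k → ∄ (T , PT , ∣T∣≡1+k)))) ∃P

  ∃-largest : ∃ P → ∃ λ S → P S × (∀ T → P T → ∣ T ∣ ≤ ∣ S ∣)
  ∃-largest = largest-below n (λ T _ → ∣p∣≤n T)

stable? : (E : Adj n) → Decidable (Stable E)
stable? E S = all? λ x → all? λ y → x ∈? S →-dec y ∈? S →-dec E x y Bool.≟ false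

stableIn? : (E : Adj n) (U : Subset n) → Decidable (StableIn E U)
stableIn? E U S = S ⊆? U ×-dec stable? E S

stable-⊆ : T ⊆ S → Stable E S → Stable E T
stable-⊆ T⊆S st x y x∈T y∈T = st x y (T⊆S x∈T) (T⊆S y∈T)

Ω-nonempty : (E : Adj n) → ∃ (InOmega E)
Ω-nonempty E = ∃-largest (stableIn? E ⊤) (⊥ , ⊆⊤ , λ x y x∈⊥ → ⊥-elim (∉⊥ x∈⊥))

Ω⇒HasAlpha : InOmega E S → HasAlpha E ∣ S ∣
Ω⇒HasAlpha (S-stable , S-max) = (_ , S-stable , refl) , S-max

∣Ω∣≡α : ∀ {U} → HasAlphaIn E U k → InOmegaIn E U S → ∣ S ∣ ≡ k
∣Ω∣≡α ((W , W-stable , ∣W∣≡k) , α-bound) (S-stable , S-max) =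
  ≤-antisym (α-bound _ S-stable) (subst (_≤ _) ∣W∣≡k (S-max W W-stable))

HasAlpha-supergraph⇔ : (∀ {S} → Stable E′ S → Stable E S) → HasAlpha E k →
  HasAlpha E′ k ⇔ ∃ λ S → InOmega E S × Stable E′ S
HasAlpha-supergraph⇔ {E′ = E′} {E = E} {k = k} shrink α =
  mk⇔ to from
  where
  to : HasAlpha E′ k → ∃ λ S → InOmega E S × Stable E′ S
  to ((S , (_ , st′) , ∣S∣≡k) , _) =
    S , ((⊆⊤ , shrink st′) , λ T T-stable → subst (∣ T ∣ ≤_) (sym ∣S∣≡k) (proj₂ α T T-stable))
      , st′
  from : (∃ λ S → InOmega E S × Stable E′ S) → HasAlpha E′ k
  from (S , S∈Ω , st′) =
    (S , (⊆⊤ , st′) , ∣Ω∣≡α α S∈Ω)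
      , λ T (_ , T-stable′) → proj₂ α T (⊆⊤ , shrink T-stable′)

==-refl : (x : Fin n) → (x == x) ≡ true
==-refl x = dec-true (x ≟ᶠ x) refl

==-∉ : x ∈ S → a ∉ S → (x == a) ≡ false
==-∉ {x = x} {a = a} x∈S a∉S = dec-false (x ≟ᶠ a) λ { refl → a∉S x∈S }

addEdge-joins : (E : Adj n) (a b : Fin n) → addEdge E a b a b ≡ true
addEdge-joins E a b rewrite ==-refl a | ==-refl b = ∨-zeroʳ (E a b)

stable-addEdge⁻ : (E : Adj n) (a b : Fin n) → Stable (addEdge E a b) S → Stable E S
stable-addEdge⁻ E a b st x y x∈S y∈S with E x y | st x y x∈S y∈S
... | false | _ = refl

stable-addEdge⁺ : Stable E S → a ∉ S ⊎ b ∉ S → Stable (addEdge E a b) S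
stable-addEdge⁺ {a = a} {b = b} st (inj₁ a∉S) x y x∈S y∈S
  rewrite st x y x∈S y∈S | ==-∉ x∈S a∉S | ==-∉ y∈S a∉S = ∧-zeroʳ (x == b)
stable-addEdge⁺ {a = a} {b = b} st (inj₂ b∉S) x y x∈S y∈S
  rewrite st x y x∈S y∈S | ==-∉ x∈S b∉S | ==-∉ y∈S b∉S | ∧-zeroʳ (x == a) = refl

stable-addEdge-∉ : (E : Adj n) (a b : Fin n) → Stable (addEdge E a b) S → a ∈ S → b ∉ S
stable-addEdge-∉ E a b st a∈S b∈S
  with trans (sym (addEdge-joins E a b)) (st a b a∈S b∈S)
... | ()

stable-addP3⁺ : Stable E S → a ∉ S ⊎ (b ∉ S × c ∉ S) →
  Stable (addEdge (addEdge E a b) a c) S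
stable-addP3⁺ st (inj₁ a∉S)          = stable-addEdge⁺ (stable-addEdge⁺ st (inj₁ a∉S)) (inj₁ a∉S)
stable-addP3⁺ st (inj₂ (b∉S , c∉S)) = stable-addEdge⁺ (stable-addEdge⁺ st (inj₂ b∉S)) (inj₂ c∉S)

stable-addP3⁻ : (E : Adj n) (a b c : Fin n) →
  Stable (addEdge (addEdge E a b) a c) S → a ∈ S → b ∉ S × c ∉ S
stable-addP3⁻ E a b c st a∈S =
    stable-addEdge-∉ E a b (stable-addEdge⁻ (addEdge E a b) a c st) a∈S
  , stable-addEdge-∉ (addEdge E a b) a c st a∈S

ΩSurvivesP3 : Graph n → Set
ΩSurvivesP3 G = ∀ a b c → NonEdge G a b → NonEdge G a c →
  ∃ λ S → InOmega (adj G) S × Stable (addEdge (addEdge (adj G) a b) a c) S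

P3Stable⇔ΩSurvivesP3 : (G : Graph n) → P3Stable G ⇔ ΩSurvivesP3 G
P3Stable⇔ΩSurvivesP3 G = mk⇔ to from
  where
  shrink : Stable (addEdge (addEdge (adj G) a b) a c) S → Stable (adj G) S
  shrink {a = a} {b = b} {c = c} st =
    stable-addEdge⁻ (adj G) a b (stable-addEdge⁻ (addEdge (adj G) a b) a c st)
  to : P3Stable G → ΩSurvivesP3 G
  to p3 a b c ab ac =
    let _ , S∈Ω = Ω-nonempty (adj G)
        α = Ω⇒HasAlpha S∈Ω
    in Equivalence.to (HasAlpha-supergraph⇔ shrink α) (p3 a b c ab ac _ α)
  from : ΩSurvivesP3 G → P3Stable G
  from survives a b c ab ac _ α =
    Equivalence.from (HasAlpha-supergraph⇔ shrink α) (survives a b c ab ac)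

module _ (G : Graph n) (v : Fin n) where

  NonEdge⇒∈V₀ : NonEdge G v x → x ∈ V₀ G v
  NonEdge⇒∈V₀ {x = x} (v≢x , vx∉E) = lookup⇒[]= x (V₀ G v) (begin
    lookup (V₀ G v) x             ≡⟨ lookup∘tabulate _ x ⟩
    not ((x == v) ∨ adj G v x)    ≡⟨ cong₂ (λ p q → not (p ∨ q)) x≠v vx∉E ⟩
    true                          ∎)
    where
    open ≡-Reasoning
    x≠v : (x == v) ≡ false
    x≠v = dec-false (x ≟ᶠ v) (v≢x ∘ sym)

  ∈V₀⇒NonEdge : x ∈ V₀ G v → NonEdge G v x
  ∈V₀⇒NonEdge {x = x} x∈V₀
    with x ≟ᶠ v | adj G v x | trans (sym (lookup∘tabulate _ x)) ([]=⇒lookup x∈V₀)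
  ... | no x≢v | false | _ = x≢v ∘ sym , refl
  ... | yes _  | _     | ()
  ... | no _   | true  | ()

  v∉V₀ : v ∉ V₀ G v
  v∉V₀ v∈V₀ = proj₁ (∈V₀⇒NonEdge v∈V₀) refl

  insert-stable : StableIn (adj G) (V₀ G v) T → Stable (adj G) (⁅ v ⁆ ∪ T)
  insert-stable {T = T} (T⊆V₀ , T-stable) x y x∈ y∈
    with x∈p∪q⁻ ⁅ v ⁆ T x∈ | x∈p∪q⁻ ⁅ v ⁆ T y∈
  ... | inj₁ x∈⁅v⁆ | inj₁ y∈⁅v⁆
    rewrite x∈⁅y⁆⇒x≡y v x∈⁅v⁆ | x∈⁅y⁆⇒x≡y v y∈⁅v⁆ = irrefl G v
  ... | inj₁ x∈⁅v⁆ | inj₂ y∈T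
    rewrite x∈⁅y⁆⇒x≡y v x∈⁅v⁆ = proj₂ (∈V₀⇒NonEdge (T⊆V₀ y∈T))
  ... | inj₂ x∈T   | inj₁ y∈⁅v⁆
    rewrite x∈⁅y⁆⇒x≡y v y∈⁅v⁆ =
      trans (Graph.sym G x v) (proj₂ (∈V₀⇒NonEdge (T⊆V₀ x∈T)))
  ... | inj₂ x∈T   | inj₂ y∈T   = T-stable x y x∈T y∈T

  remove-stable : Stable (adj G) S → v ∈ S → StableIn (adj G) (V₀ G v) (S - v)
  remove-stable {S = S} S-stable v∈S = S-v⊆V₀ , stable-⊆ (p─q⊆p S ⁅ v ⁆) S-stable
    where
    S-v⊆V₀ : S - v ⊆ V₀ G v
    S-v⊆V₀ {x} x∈S-v = NonEdge⇒∈V₀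
      (x∈p-y⇒x≢y x∈S-v ∘ sym , S-stable v x v∈S (p─q⊆p S ⁅ v ⁆ x∈S-v))

  ∣⁅v⁆∪T∣≡1+∣T∣ : StableIn (adj G) (V₀ G v) T → ∣ ⁅ v ⁆ ∪ T ∣ ≡ suc ∣ T ∣
  ∣⁅v⁆∪T∣≡1+∣T∣ {T = T} (T⊆V₀ , _) = ∣⁅x⁆∪p∣≡1+∣p∣ T (v∉V₀ ∘ T⊆V₀)

PairsMissedByΩ₀ : Graph n → Fin n → Set
PairsMissedByΩ₀ {n} G v = ∀ x y → x ∈ V₀ G v → y ∈ V₀ G v →
  Σ (Subset n) λ S₀ → InOmegaIn (adj G) (V₀ G v) S₀ × x ∉ S₀ × y ∉ S₀

module _ (G : Graph n) (v : Fin n) (v∈core : InCore (adj G) v) where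

  open ≤-Reasoning

  Ω-remove : InOmega (adj G) S → InOmegaIn (adj G) (V₀ G v) (S - v)
  Ω-remove {S = S} S∈Ω@((_ , S-stable) , S-max) =
    remove-stable G v S-stable v∈S , S-v-max
    where
    v∈S : v ∈ S
    v∈S = v∈core S S∈Ω
    S-v-max : ∀ T₀ → StableIn (adj G) (V₀ G v) T₀ → ∣ T₀ ∣ ≤ ∣ S - v ∣
    S-v-max T₀ T₀-stable = ≤-pred (begin
      suc ∣ T₀ ∣       ≡⟨ sym (∣⁅v⁆∪T∣≡1+∣T∣ G v T₀-stable) ⟩
      ∣ ⁅ v ⁆ ∪ T₀ ∣   ≤⟨ S-max _ (⊆⊤ , insert-stable G v T₀-stable) ⟩
      ∣ S ∣            ≡⟨ ∣p∣≡1+∣p-x∣ S v∈S ⟩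
      suc ∣ S - v ∣    ∎)

  Ω-insert : InOmegaIn (adj G) (V₀ G v) S₀ → InOmega (adj G) (⁅ v ⁆ ∪ S₀)
  Ω-insert {S₀ = S₀} (S₀-stable , S₀-max) =
    (⊆⊤ , insert-stable G v S₀-stable) , ⁅v⁆∪S₀-max
    where
    ⁅v⁆∪S₀-max : ∀ T → StableIn (adj G) ⊤ T → ∣ T ∣ ≤ ∣ ⁅ v ⁆ ∪ S₀ ∣
    ⁅v⁆∪S₀-max T T-stable with Ω-nonempty (adj G)
    ... | S , S∈Ω@((_ , S-stable) , S-max) = begin
      ∣ T ∣               ≤⟨ S-max T T-stable ⟩
      ∣ S ∣               ≡⟨ ∣p∣≡1+∣p-x∣ S (v∈core S S∈Ω) ⟩
      suc ∣ S - v ∣       ≤⟨ s≤s (S₀-max _ (remove-stable G v S-stable (v∈core S S∈Ω))) ⟩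
      suc ∣ S₀ ∣          ≡⟨ sym (∣⁅v⁆∪T∣≡1+∣T∣ G v S₀-stable) ⟩
      ∣ ⁅ v ⁆ ∪ S₀ ∣      ∎

  Ω-avoiding : PairsMissedByΩ₀ G v → a ≢ v → ∃ λ S → InOmega (adj G) S × a ∉ S
  Ω-avoiding {a = a} missed a≢v with Ω-nonempty (adj G)
  ... | S , S∈Ω with a ∈? S
  ...   | no a∉S = S , S∈Ω , a∉S
  ...   | yes a∈S =
    let a∈V₀ = NonEdge⇒∈V₀ G v (a≢v ∘ sym , proj₂ (proj₁ S∈Ω) v a (v∈core S S∈Ω) a∈S)
        S₀ , S₀∈Ω₀ , a∉S₀ , _ = missed a a a∈V₀ a∈V₀
    in ⁅ v ⁆ ∪ S₀ , Ω-insert S₀∈Ω₀ , x≢y∧x∉p⇒x∉⁅y⁆∪p a≢v a∉S₀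

  ΩSurvivesP3⇔PairsMissedByΩ₀ : ΩSurvivesP3 G ⇔ PairsMissedByΩ₀ G v
  ΩSurvivesP3⇔PairsMissedByΩ₀ = mk⇔ to from
    where
    to : ΩSurvivesP3 G → PairsMissedByΩ₀ G v
    to survives x y x∈V₀ y∈V₀ =
      let S , S∈Ω , S-stable′ =
            survives v x y (∈V₀⇒NonEdge G v x∈V₀) (∈V₀⇒NonEdge G v y∈V₀)
          x∉S , y∉S = stable-addP3⁻ (adj G) v x y S-stable′ (v∈core S S∈Ω)
      in S - v , Ω-remove S∈Ω , x∉S ∘ p─q⊆p S ⁅ v ⁆ , y∉S ∘ p─q⊆p S ⁅ v ⁆
    from : PairsMissedByΩ₀ G v → ΩSurvivesP3 G
    from missed a b c ab ac with a ≟ᶠ v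
    ... | yes refl =
      let S₀ , S₀∈Ω₀@(S₀-stable , _) , b∉S₀ , c∉S₀ =
            missed b c (NonEdge⇒∈V₀ G v ab) (NonEdge⇒∈V₀ G v ac)
      in ⁅ v ⁆ ∪ S₀ , Ω-insert S₀∈Ω₀
         , stable-addP3⁺ (insert-stable G v S₀-stable)
             (inj₂ ( x≢y∧x∉p⇒x∉⁅y⁆∪p (proj₁ ab ∘ sym) b∉S₀
                   , x≢y∧x∉p⇒x∉⁅y⁆∪p (proj₁ ac ∘ sym) c∉S₀))
    ... | no a≢v =
      let S , S∈Ω , a∉S = Ω-avoiding missed a≢v
      in S , S∈Ω , stable-addP3⁺ (proj₂ (proj₁ S∈Ω)) (inj₁ a∉S)

theorem2 : ∀ {n} (G : Graph n) (v : Fin n) → CoreIsSingleton G v →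
    (P3Stable G ⇔
      (∀ x y → x ∈ V₀ G v → y ∈ V₀ G v →
        Σ (Subset n) λ S₀ → InOmegaIn (adj G) (V₀ G v) S₀ × x ∉ S₀ × y ∉ S₀))
theorem2 G v (v∈core , _) =
  ΩSurvivesP3⇔PairsMissedByΩ₀ G v v∈core ⇔-∘ P3Stable⇔ΩSurvivesP3 G
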